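{- Let $\mathbb{K}$ be a field of characteristic zero and let $f,g\in\mathbb{K}[[x]]$ with $f(0)\neq0$ and $g(0)\neq0$. Let $A$ be the $A$-sequence of the Riordan matrix $T(f\mid g)$. Then \[ T^{ -1}(f\mid g)=T(1\mid A)\,T\left(\frac{1}{f}\,\Big|\,1\right). \]
   Context: For $f,g\in\mathbb{K}[[x]]$ with $g(0)\neq0$, $T(f\mid g)=(d_{n,k})_{n,k\geq0}$ denotes the infinite lower triangular matrix with $d_{n,k}=[x^n]\frac{x^kf}{g^{k+1}}$ ($[x^j]S$ is the coefficient of $x^j$ in $S$). Products are the usual matrix products of infinite lower triangular matrices and $T^{ -1}(f\mid g)$ is the matrix inverse (which exists when $f(0)g(0)\neq0$). The $A$-sequence of $T(f\mid g)=(d_{n,k})$ is the unique power series $A=\sum_{j\geq0}a_jx^j$ such that $d_{n+1,k+1}=\sum_{j\geq0}a_jd_{n,k+j}$ for all $n,k\geq0$. -}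

module Defs where

open import Level using (_⊔_) renaming (suc to lsuc)
open import Algebra.Bundles using (CommutativeRing)
open import Data.Nat using (ℕ; zero; suc; _∸_; _≤?_; _≟_)
open import Relation.Nullary using (¬_; yes; no)

-- A (discrete) field: a commutative ring with 0 ≠ 1 in which every
-- nonzero element has a multiplicative inverse.  The inverse is given as a
-- total function whose value at 0 is irrelevant.
record Field (c ℓ : Level.Level) : Set (lsuc (c ⊔ ℓ)) where
  field
    commutativeRing : CommutativeRing c ℓ
  open CommutativeRing commutativeRing public
  field
    _⁻¹        : Carrier → Carrier
    ⁻¹-inverse : ∀ x → ¬ (x ≈ 0#) → (x * (x ⁻¹)) ≈ 1#
    0≉1        : ¬ (0# ≈ 1#)

module Riordan {c ℓ} (K : Field c ℓ) where
  open Field K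

  ofℕ : ℕ → Carrier
  ofℕ zero    = 0#
  ofℕ (suc n) = 1# + ofℕ n

  CharZero : Set ℓ
  CharZero = ∀ n → ¬ (ofℕ (suc n) ≈ 0#)

  Σ≤ : ℕ → (ℕ → Carrier) → Carrier
  Σ≤ zero    h = h 0
  Σ≤ (suc n) h = Σ≤ n h + h (suc n)

  Series : Set c
  Series = ℕ → Carrier

  ConstTermNonzero : Series → Set ℓ
  ConstTermNonzero a = ¬ (a 0 ≈ 0#)

  coeff : ℕ → Series → Carrier
  coeff n a = a n

  one : Series
  one zero    = 1#
  one (suc _) = 0#

  _*ₛ_ : Series → Series → Series
  (a *ₛ b) n = Σ≤ n (λ i → a i * b (n ∸ i))

  _^ₛ_ : Series → ℕ → Series
  a ^ₛ zero  = one
  a ^ₛ suc m = a *ₛ (a ^ₛ m)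

  xpow : ℕ → Series → Series
  xpow k a n with k ≤? n
  ... | yes _ = a (n ∸ k)
  ... | no  _ = 0#

  -- reciprocal 1/a (meaningful when a 0 ≠ 0):
  -- b 0 = a0⁻¹,  b (m+1) = - a0⁻¹ Σ_{i=1}^{m+1} a i b (m+1-i)
  -- invPrefix n agrees with 1/a in degrees ≤ n.
  invPrefix : Series → ℕ → Series
  invPrefix a zero    zero    = a 0 ⁻¹
  invPrefix a zero    (suc _) = 0#
  invPrefix a (suc n) k with k ≤? n
  ... | yes _ = invPrefix a n k
  ... | no  _ with k ≟ suc n
  ...   | yes _ = - (a 0 ⁻¹ * Σ≤ n (λ j → a (suc j) * invPrefix a n (n ∸ j)))
  ...   | no  _ = 0#

  inv : Series → Series
  inv a n = invPrefix a n n

  -- infinite (lower triangular) matrices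
  Matrix : Set c
  Matrix = ℕ → ℕ → Carrier

  T : Series → Series → Matrix
  T f g n k = coeff n (xpow k (f *ₛ inv (g ^ₛ suc k)))

  -- product of lower triangular matrices: (M N)_{n,k} = Σ_{j=0}^{n} M_{n,j} N_{j,k}
  -- (the terms with j > n vanish for lower triangular M)
  _·_ : Matrix → Matrix → Matrix
  (M · N) n k = Σ≤ n (λ j → M n j * N j k)

  I : Matrix
  I n k with n ≟ k
  ... | yes _ = 1#
  ... | no  _ = 0#

  _≈ₘ_ : Matrix → Matrix → Set ℓ
  M ≈ₘ N = ∀ n k → M n k ≈ N n k

  IsInverseOf : Matrix → Matrix → Set ℓ
  IsInverseOf N M = ((M · N) ≈ₘ I) × ((N · M) ≈ₘ I)
    where open import Data.Product using (_×_)

  -- A is the A-sequence of D: d_{n+1,k+1} = Σ_{j≥0} a_j d_{n,k+j}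
  -- (for the lower triangular D only j ≤ n can contribute)
  IsASequence : Matrix → Series → Set ℓ
  IsASequence D A = ∀ n k → D (suc n) (suc k) ≈ Σ≤ n (λ j → A j * D n (k Data.Nat.+ j))

module Submission where

-- Writing shift M for M with its first
-- row and column deleted, the A-sequence relation says shift D = D T(A | 1) for
-- D = T(f | g).  Since T(f | g) = T(f | 1) T(1 | g) and Toeplitz matrices T(u | 1)
-- commute with shift, A is also the A-sequence of E = T(1 | g).  Then
-- P = E (1 ⊕ T(1 | A)) is shift-invariant with first column 1/g, so P = T(1/g | 1),
-- and from 1 ⊕ E = T(g | 1) E one gets E T(1 | A) = I.  For lower triangular
-- matrices one-sided inverses are two-sided, and T(1/f | 1) T(f | g) = E finishes.

open import Defs
open import Level using (Level)
open import Data.Nat using (ℕ; zero; suc; _∸_; _≤_; _<_; z≤n; s≤s; _≤?_; _≟_)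
import Data.Nat as Nat
import Data.Nat.Properties as ℕₚ
open import Data.Empty using (⊥-elim)
open import Data.Sum using (inj₁; inj₂)
open import Data.Product using (_,_)
open import Relation.Nullary using (¬_; yes; no)
import Relation.Binary.PropositionalEquality as ≡

module RiordanInverse {c ℓ} (K : Field c ℓ) where
  open Field K hiding (zero)
  open Riordan K
  open import Relation.Binary.Reasoning.Setoid setoid
  open import Algebra.Properties.Ring ring using (-‿distribʳ-*)
  open import Algebra.Properties.Group +-group using () renaming (∙-cancelˡ to +-cancelˡ)
  open import Algebra.Properties.CommutativeSemigroup +-commutativeSemigroup
    using () renaming (interchange to +-interchange)

  *-cancelˡ-nonzero : ∀ {x a b} → x ≉ 0# → x * a ≈ x * b → a ≈ b
  *-cancelˡ-nonzero {x} {a} {b} x≉0 xa≈xb = begin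
      a               ≈⟨ *-identityˡ a ⟨
      1# * a          ≈⟨ *-congʳ x⁻¹x≈1 ⟨
      (x ⁻¹ * x) * a  ≈⟨ *-assoc _ _ _ ⟩
      x ⁻¹ * (x * a)  ≈⟨ *-congˡ xa≈xb ⟩
      x ⁻¹ * (x * b)  ≈⟨ *-assoc _ _ _ ⟨
      (x ⁻¹ * x) * b  ≈⟨ *-congʳ x⁻¹x≈1 ⟩
      1# * b          ≈⟨ *-identityˡ b ⟩
      b               ∎
    where
      x⁻¹x≈1 : x ⁻¹ * x ≈ 1#
      x⁻¹x≈1 = trans (*-comm _ _) (⁻¹-inverse x x≉0)

  *-nonzero : ∀ {x y} → x ≉ 0# → y ≉ 0# → x * y ≉ 0#
  *-nonzero {x} x≉0 y≉0 xy≈0 = y≉0 (*-cancelˡ-nonzero x≉0 (trans xy≈0 (sym (zeroʳ x))))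

  ⁻¹-nonzero : ∀ {x} → x ≉ 0# → x ⁻¹ ≉ 0#
  ⁻¹-nonzero {x} x≉0 x⁻¹≈0 = 0≉1 (begin
      0#        ≈⟨ zeroʳ x ⟨
      x * 0#    ≈⟨ *-congˡ x⁻¹≈0 ⟨
      x * x ⁻¹  ≈⟨ ⁻¹-inverse x x≉0 ⟩
      1#        ∎)

  1≉0 : 1# ≉ 0#
  1≉0 1≈0 = 0≉1 (sym 1≈0)

  Σ-cong≤ : ∀ n {h h' : ℕ → Carrier} → (∀ i → i ≤ n → h i ≈ h' i) → Σ≤ n h ≈ Σ≤ n h'
  Σ-cong≤ zero    h≈h' = h≈h' 0 z≤n
  Σ-cong≤ (suc n) h≈h' = +-cong (Σ-cong≤ n (λ i i≤n → h≈h' i (ℕₚ.m≤n⇒m≤1+n i≤n)))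
                                (h≈h' (suc n) ℕₚ.≤-refl)

  Σ-cong : ∀ n {h h' : ℕ → Carrier} → (∀ i → h i ≈ h' i) → Σ≤ n h ≈ Σ≤ n h'
  Σ-cong n h≈h' = Σ-cong≤ n (λ i _ → h≈h' i)

  Σ-zero : ∀ n {h : ℕ → Carrier} → (∀ i → i ≤ n → h i ≈ 0#) → Σ≤ n h ≈ 0#
  Σ-zero zero    h≈0 = h≈0 0 z≤n
  Σ-zero (suc n) h≈0 = trans (+-cong (Σ-zero n (λ i i≤n → h≈0 i (ℕₚ.m≤n⇒m≤1+n i≤n)))
                                     (h≈0 (suc n) ℕₚ.≤-refl))
                             (+-identityˡ 0#)

  Σ-+ : ∀ n (a b : ℕ → Carrier) → Σ≤ n (λ i → a i + b i) ≈ Σ≤ n a + Σ≤ n b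
  Σ-+ zero    a b = refl
  Σ-+ (suc n) a b = trans (+-congʳ (Σ-+ n a b)) (+-interchange _ _ _ _)

  Σ-*ˡ : ∀ n x (h : ℕ → Carrier) → x * Σ≤ n h ≈ Σ≤ n (λ i → x * h i)
  Σ-*ˡ zero    x h = refl
  Σ-*ˡ (suc n) x h = trans (distribˡ _ _ _) (+-congʳ (Σ-*ˡ n x h))

  Σ-*ʳ : ∀ n x (h : ℕ → Carrier) → Σ≤ n h * x ≈ Σ≤ n (λ i → h i * x)
  Σ-*ʳ n x h = trans (*-comm _ _) (trans (Σ-*ˡ n x h) (Σ-cong n (λ i → *-comm _ _)))

  Σ-first : ∀ n (h : ℕ → Carrier) → Σ≤ (suc n) h ≈ h 0 + Σ≤ n (λ i → h (suc i))
  Σ-first zero    h = refl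
  Σ-first (suc n) h = trans (+-congʳ (Σ-first n h)) (+-assoc _ _ _)

  Σ-extend : ∀ m n (h : ℕ → Carrier) → m ≤ n → (∀ j → m < j → j ≤ n → h j ≈ 0#) →
             Σ≤ m h ≈ Σ≤ n h
  Σ-extend m zero    h z≤n  _   = refl
  Σ-extend m (suc n) h m≤1+n h≈0 with ℕₚ.m≤n⇒m<n∨m≡n m≤1+n
  ... | inj₂ ≡.refl = refl
  ... | inj₁ m<1+n  = begin
      Σ≤ m h              ≈⟨ +-identityʳ _ ⟨
      Σ≤ m h + 0#         ≈⟨ +-cong (Σ-extend m n h m≤n (λ j m<j j≤n → h≈0 j m<j (ℕₚ.m≤n⇒m≤1+n j≤n)))
                                    (sym (h≈0 (suc n) m<1+n ℕₚ.≤-refl)) ⟩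
      Σ≤ n h + h (suc n)  ∎
    where
      m≤n : m ≤ n
      m≤n = ℕₚ.≤-pred m<1+n

  Σ-swap : ∀ m n (F : ℕ → ℕ → Carrier) →
           Σ≤ m (λ j → Σ≤ n (λ i → F i j)) ≈ Σ≤ n (λ i → Σ≤ m (λ j → F i j))
  Σ-swap zero    n F = refl
  Σ-swap (suc m) n F = trans (+-congʳ (Σ-swap m n F)) (sym (Σ-+ n _ _))

  Σ-reindex : ∀ k n (φ : ℕ → Carrier) → (∀ i → i < k → φ i ≈ 0#) → (∀ i → n < i → φ i ≈ 0#) →
              Σ≤ n φ ≈ Σ≤ n (λ j → φ (k Nat.+ j))
  Σ-reindex zero    n φ _   _   = refl
  Σ-reindex (suc k) n φ low high = begin
      Σ≤ n φ                           ≈⟨ dropFirst n φ (low 0 (s≤s z≤n)) (high (suc n) ℕₚ.≤-refl) ⟩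
      Σ≤ n (λ i → φ (suc i))           ≈⟨ Σ-reindex k n (λ i → φ (suc i)) (λ i i<k → low (suc i) (s≤s i<k))
                                              (λ i n<i → high (suc i) (ℕₚ.m≤n⇒m≤1+n n<i)) ⟩
      Σ≤ n (λ j → φ (suc k Nat.+ j))   ∎
    where
      dropFirst : ∀ n (ψ : ℕ → Carrier) → ψ 0 ≈ 0# → ψ (suc n) ≈ 0# →
                  Σ≤ n ψ ≈ Σ≤ n (λ i → ψ (suc i))
      dropFirst zero    ψ ψ0≈0 ψ1≈0 = trans ψ0≈0 (sym ψ1≈0)
      dropFirst (suc n) ψ ψ0≈0 ψlast≈0 = begin
          Σ≤ (suc n) ψ                         ≈⟨ Σ-first n ψ ⟩
          ψ 0 + Σ≤ n (λ i → ψ (suc i))         ≈⟨ +-congʳ ψ0≈0 ⟩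
          0# + Σ≤ n (λ i → ψ (suc i))          ≈⟨ +-comm _ _ ⟩
          Σ≤ n (λ i → ψ (suc i)) + 0#          ≈⟨ +-congˡ ψlast≈0 ⟨
          Σ≤ (suc n) (λ i → ψ (suc i))         ∎

  infix 4 _≈ₛ_
  _≈ₛ_ : Series → Series → Set ℓ
  a ≈ₛ b = ∀ n → a n ≈ b n

  -- tail a = (a - a 0) / x
  tail : Series → Series
  tail a i = a (suc i)

  *ₛ-cong : ∀ {a a' b b'} → a ≈ₛ a' → b ≈ₛ b' → a *ₛ b ≈ₛ a' *ₛ b'
  *ₛ-cong a≈a' b≈b' n = Σ-cong n (λ i → *-cong (a≈a' i) (b≈b' (n ∸ i)))

  *ₛ-congˡ : ∀ a {b b'} → b ≈ₛ b' → a *ₛ b ≈ₛ a *ₛ b'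
  *ₛ-congˡ a = *ₛ-cong {a} (λ _ → refl)

  *ₛ-congʳ : ∀ {a a'} b → a ≈ₛ a' → a *ₛ b ≈ₛ a' *ₛ b
  *ₛ-congʳ b a≈a' = *ₛ-cong {b = b} a≈a' (λ _ → refl)

  *ₛ-suc : ∀ a b n → (a *ₛ b) (suc n) ≈ a 0 * b (suc n) + (tail a *ₛ b) n
  *ₛ-suc a b n = Σ-first n (λ i → a i * b (suc n ∸ i))

  *ₛ-suc′ : ∀ a b n → (a *ₛ b) (suc n) ≈ (a *ₛ tail b) n + a (suc n) * b 0
  *ₛ-suc′ a b n = +-cong (Σ-cong≤ n (λ i i≤n → *-congˡ (reflexive (≡.cong b (ℕₚ.+-∸-assoc 1 i≤n)))))
                         (*-congˡ (reflexive (≡.cong b (ℕₚ.n∸n≡0 n))))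

  *ₛ-comm : ∀ a b → a *ₛ b ≈ₛ b *ₛ a
  *ₛ-comm a b zero    = *-comm _ _
  *ₛ-comm a b (suc n) = begin
      (a *ₛ b) (suc n)                     ≈⟨ *ₛ-suc a b n ⟩
      a 0 * b (suc n) + (tail a *ₛ b) n    ≈⟨ +-cong (*-comm _ _) (*ₛ-comm (tail a) b n) ⟩
      b (suc n) * a 0 + (b *ₛ tail a) n    ≈⟨ +-comm _ _ ⟩
      (b *ₛ tail a) n + b (suc n) * a 0    ≈⟨ *ₛ-suc′ b a n ⟨
      (b *ₛ a) (suc n)                     ∎

  *ₛ-linearˡ : ∀ x u v w n → ((λ i → x * u i + v i) *ₛ w) n ≈ x * (u *ₛ w) n + (v *ₛ w) n
  *ₛ-linearˡ x u v w n = begin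
      Σ≤ n (λ i → (x * u i + v i) * w (n ∸ i))
        ≈⟨ Σ-cong n (λ i → trans (distribʳ _ _ _) (+-congʳ (*-assoc _ _ _))) ⟩
      Σ≤ n (λ i → x * (u i * w (n ∸ i)) + v i * w (n ∸ i))
        ≈⟨ Σ-+ n _ _ ⟩
      Σ≤ n (λ i → x * (u i * w (n ∸ i))) + (v *ₛ w) n
        ≈⟨ +-congʳ (Σ-*ˡ n x _) ⟨
      x * (u *ₛ w) n + (v *ₛ w) n
        ∎

  *ₛ-assoc : ∀ a b c → (a *ₛ b) *ₛ c ≈ₛ a *ₛ (b *ₛ c)
  *ₛ-assoc a b c zero    = *-assoc _ _ _
  *ₛ-assoc a b c (suc n) = begin
      ((a *ₛ b) *ₛ c) (suc n)
        ≈⟨ *ₛ-suc (a *ₛ b) c n ⟩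
      (a 0 * b 0) * c (suc n) + (tail (a *ₛ b) *ₛ c) n
        ≈⟨ +-congˡ (*ₛ-congʳ c (*ₛ-suc a b) n) ⟩
      (a 0 * b 0) * c (suc n) + ((λ i → a 0 * b (suc i) + (tail a *ₛ b) i) *ₛ c) n
        ≈⟨ +-congˡ (*ₛ-linearˡ (a 0) (tail b) (tail a *ₛ b) c n) ⟩
      (a 0 * b 0) * c (suc n) + (a 0 * (tail b *ₛ c) n + ((tail a *ₛ b) *ₛ c) n)
        ≈⟨ +-assoc _ _ _ ⟨
      ((a 0 * b 0) * c (suc n) + a 0 * (tail b *ₛ c) n) + ((tail a *ₛ b) *ₛ c) n
        ≈⟨ +-cong (trans (+-congʳ (*-assoc _ _ _)) (sym (distribˡ _ _ _))) (*ₛ-assoc (tail a) b c n) ⟩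
      a 0 * (b 0 * c (suc n) + (tail b *ₛ c) n) + (tail a *ₛ (b *ₛ c)) n
        ≈⟨ +-congʳ (*-congˡ (*ₛ-suc b c n)) ⟨
      a 0 * (b *ₛ c) (suc n) + (tail a *ₛ (b *ₛ c)) n
        ≈⟨ *ₛ-suc a (b *ₛ c) n ⟨
      (a *ₛ (b *ₛ c)) (suc n)
        ∎

  one-*ₛ : ∀ a → one *ₛ a ≈ₛ a
  one-*ₛ a zero    = *-identityˡ _
  one-*ₛ a (suc n) = begin
      (one *ₛ a) (suc n)                    ≈⟨ *ₛ-suc one a n ⟩
      1# * a (suc n) + (tail one *ₛ a) n    ≈⟨ +-cong (*-identityˡ _) (Σ-zero n (λ i _ → zeroˡ _)) ⟩
      a (suc n) + 0#                        ≈⟨ +-identityʳ _ ⟩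
      a (suc n)                             ∎

  *ₛ-one : ∀ a → a *ₛ one ≈ₛ a
  *ₛ-one a n = trans (*ₛ-comm a one n) (one-*ₛ a n)

  -- Reciprocals.  `inv a` is defined by the recursion of invPrefix; each
  -- prefix is stable, so `inv a` agrees with every prefix on its range.

  invPrefix-step : ∀ a n k → k ≤ n → invPrefix a (suc n) k ≡.≡ invPrefix a n k
  invPrefix-step a n k k≤n with k ≤? n
  ... | yes _   = ≡.refl
  ... | no  k≰n = ⊥-elim (k≰n k≤n)

  invPrefix-stable : ∀ a n k → k ≤ n → invPrefix a n k ≡.≡ inv a k
  invPrefix-stable a zero    .zero z≤n = ≡.refl
  invPrefix-stable a (suc n) k k≤1+n with ℕₚ.m≤n⇒m<n∨m≡n k≤1+n
  ... | inj₂ ≡.refl = ≡.refl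
  ... | inj₁ k<1+n  = ≡.trans (invPrefix-step a n k (ℕₚ.≤-pred k<1+n))
                              (invPrefix-stable a n k (ℕₚ.≤-pred k<1+n))

  inv-suc : ∀ a n → inv a (suc n) ≡.≡ - (a 0 ⁻¹ * Σ≤ n (λ j → a (suc j) * invPrefix a n (n ∸ j)))
  inv-suc a n with suc n ≤? n
  ... | yes 1+n≤n = ⊥-elim (ℕₚ.n≮n n 1+n≤n)
  ... | no  _ with suc n ≟ suc n
  ...   | yes _ = ≡.refl
  ...   | no  n≢n = ⊥-elim (n≢n ≡.refl)

  -- a · (1/a) = 1: the recursion for inv a (n + 1) makes the degree-(n + 1)
  -- coefficient of the product cancel.
  *ₛ-inv : ∀ a → a 0 ≉ 0# → a *ₛ inv a ≈ₛ one
  *ₛ-inv a a0≉0 zero    = ⁻¹-inverse (a 0) a0≉0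
  *ₛ-inv a a0≉0 (suc n) = begin
      (a *ₛ inv a) (suc n)                       ≈⟨ *ₛ-suc a (inv a) n ⟩
      a 0 * inv a (suc n) + (tail a *ₛ inv a) n  ≈⟨ +-cong (*-congˡ (reflexive (inv-suc a n))) tail≈S ⟩
      a 0 * (- (a 0 ⁻¹ * S)) + S                 ≈⟨ +-congʳ (-‿distribʳ-* _ _) ⟨
      - (a 0 * (a 0 ⁻¹ * S)) + S                 ≈⟨ +-congʳ (-‿cong a₀[a₀⁻¹S]≈S) ⟩
      - S + S                                    ≈⟨ -‿inverseˡ S ⟩
      0#                                         ∎
    where
      S : Carrier
      S = Σ≤ n (λ j → a (suc j) * invPrefix a n (n ∸ j))

      tail≈S : (tail a *ₛ inv a) n ≈ S
      tail≈S = Σ-cong n (λ j → *-congˡ (reflexive (≡.sym (invPrefix-stable a n (n ∸ j) (ℕₚ.m∸n≤m n j)))))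

      a₀[a₀⁻¹S]≈S : a 0 * (a 0 ⁻¹ * S) ≈ S
      a₀[a₀⁻¹S]≈S = trans (sym (*-assoc _ _ _)) (trans (*-congʳ (⁻¹-inverse (a 0) a0≉0)) (*-identityˡ _))

  inv-*ₛ : ∀ a → a 0 ≉ 0# → inv a *ₛ a ≈ₛ one
  inv-*ₛ a a0≉0 n = trans (*ₛ-comm (inv a) a n) (*ₛ-inv a a0≉0 n)

  inv-unique : ∀ a b → a 0 ≉ 0# → a *ₛ b ≈ₛ one → inv a ≈ₛ b
  inv-unique a b a0≉0 ab≈1 n = begin
      inv a n                   ≈⟨ *ₛ-one (inv a) n ⟨
      (inv a *ₛ one) n          ≈⟨ *ₛ-congˡ (inv a) ab≈1 n ⟨
      (inv a *ₛ (a *ₛ b)) n     ≈⟨ *ₛ-assoc (inv a) a b n ⟨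
      ((inv a *ₛ a) *ₛ b) n     ≈⟨ *ₛ-congʳ b (inv-*ₛ a a0≉0) n ⟩
      (one *ₛ b) n              ≈⟨ one-*ₛ b n ⟩
      b n                       ∎

  inv-cong : ∀ {a a'} → a 0 ≉ 0# → a ≈ₛ a' → inv a ≈ₛ inv a'
  inv-cong {a} {a'} a0≉0 a≈a' = inv-unique a (inv a') a0≉0
    (λ n → trans (*ₛ-congʳ (inv a') a≈a' n) (*ₛ-inv a' (λ a'0≈0 → a0≉0 (trans (a≈a' 0) a'0≈0)) n))

  inv-*ₛ-distrib : ∀ a b → a 0 ≉ 0# → b 0 ≉ 0# → inv (a *ₛ b) ≈ₛ inv a *ₛ inv b
  inv-*ₛ-distrib a b a0≉0 b0≉0 = inv-unique (a *ₛ b) (inv a *ₛ inv b) (*-nonzero a0≉0 b0≉0) product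
    where
      product : (a *ₛ b) *ₛ (inv a *ₛ inv b) ≈ₛ one
      product n = begin
        ((a *ₛ b) *ₛ (inv a *ₛ inv b)) n   ≈⟨ *ₛ-congʳ (inv a *ₛ inv b) (*ₛ-comm a b) n ⟩
        ((b *ₛ a) *ₛ (inv a *ₛ inv b)) n   ≈⟨ *ₛ-assoc b a (inv a *ₛ inv b) n ⟩
        (b *ₛ (a *ₛ (inv a *ₛ inv b))) n   ≈⟨ *ₛ-congˡ b (*ₛ-assoc a (inv a) (inv b)) n ⟨
        (b *ₛ ((a *ₛ inv a) *ₛ inv b)) n   ≈⟨ *ₛ-congˡ b (*ₛ-congʳ (inv b) (*ₛ-inv a a0≉0)) n ⟩
        (b *ₛ (one *ₛ inv b)) n            ≈⟨ *ₛ-congˡ b (one-*ₛ (inv b)) n ⟩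
        (b *ₛ inv b) n                     ≈⟨ *ₛ-inv b b0≉0 n ⟩
        one n                              ∎

  ^ₛ-nonzero : ∀ a m → a 0 ≉ 0# → (a ^ₛ m) 0 ≉ 0#
  ^ₛ-nonzero a zero    a0≉0 = 1≉0
  ^ₛ-nonzero a (suc m) a0≉0 = *-nonzero a0≉0 (^ₛ-nonzero a m a0≉0)

  inv-one-^ₛ : ∀ m → inv (one ^ₛ m) ≈ₛ one
  inv-one-^ₛ m = inv-unique (one ^ₛ m) one (^ₛ-nonzero one m 1≉0) (λ n → trans (*ₛ-one _ n) (one-^ₛ m n))
    where
      one-^ₛ : ∀ m → one ^ₛ m ≈ₛ one
      one-^ₛ zero    n = refl
      one-^ₛ (suc m) n = trans (*ₛ-congˡ one (one-^ₛ m) n) (one-*ₛ one n)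

  xpow-≤ : ∀ k a n → k ≤ n → xpow k a n ≡.≡ a (n ∸ k)
  xpow-≤ k a n k≤n with k ≤? n
  ... | yes _   = ≡.refl
  ... | no  k≰n = ⊥-elim (k≰n k≤n)

  xpow-> : ∀ k a n → n < k → xpow k a n ≡.≡ 0#
  xpow-> k a n n<k with k ≤? n
  ... | yes k≤n = ⊥-elim (ℕₚ.<⇒≱ n<k k≤n)
  ... | no  _   = ≡.refl

  xpow-zero : ∀ a n → xpow 0 a n ≡.≡ a n
  xpow-zero a n = xpow-≤ 0 a n z≤n

  xpow-suc-zero : ∀ k a → xpow (suc k) a 0 ≡.≡ 0#
  xpow-suc-zero k a = xpow-> (suc k) a 0 (s≤s z≤n)

  xpow-suc-suc : ∀ k a n → xpow (suc k) a (suc n) ≡.≡ xpow k a n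
  xpow-suc-suc k a n with ℕₚ.≤-<-connex k n
  ... | inj₁ k≤n = ≡.trans (xpow-≤ (suc k) a (suc n) (s≤s k≤n)) (≡.sym (xpow-≤ k a n k≤n))
  ... | inj₂ n<k = ≡.trans (xpow-> (suc k) a (suc n) (s≤s n<k)) (≡.sym (xpow-> k a n n<k))

  xpow-cong : ∀ k {a a'} → a ≈ₛ a' → xpow k a ≈ₛ xpow k a'
  xpow-cong k a≈a' n with k ≤? n
  ... | yes _ = a≈a' (n ∸ k)
  ... | no  _ = refl

  *ₛ-xpow : ∀ k u a → u *ₛ xpow k a ≈ₛ xpow k (u *ₛ a)
  *ₛ-xpow zero    u a n       = trans (*ₛ-congˡ u (λ m → reflexive (xpow-zero a m)) n)
                                      (reflexive (≡.sym (xpow-zero (u *ₛ a) n)))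
  *ₛ-xpow (suc k) u a zero    = trans (*-congˡ (reflexive (xpow-suc-zero k a)))
                                      (trans (zeroʳ _) (reflexive (≡.sym (xpow-suc-zero k (u *ₛ a)))))
  *ₛ-xpow (suc k) u a (suc n) = begin
      (u *ₛ xpow (suc k) a) (suc n)                                ≈⟨ *ₛ-comm u _ (suc n) ⟩
      (xpow (suc k) a *ₛ u) (suc n)                                ≈⟨ *ₛ-suc (xpow (suc k) a) u n ⟩
      xpow (suc k) a 0 * u (suc n) + (tail (xpow (suc k) a) *ₛ u) n
        ≈⟨ +-cong (trans (*-congʳ (reflexive (xpow-suc-zero k a))) (zeroˡ _))
                  (*ₛ-congʳ u (λ i → reflexive (xpow-suc-suc k a i)) n) ⟩
      0# + (xpow k a *ₛ u) n                                       ≈⟨ +-identityˡ _ ⟩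
      (xpow k a *ₛ u) n                                            ≈⟨ *ₛ-comm _ u n ⟩
      (u *ₛ xpow k a) n                                            ≈⟨ *ₛ-xpow k u a n ⟩
      xpow k (u *ₛ a) n                                            ≈⟨ reflexive (xpow-suc-suc k (u *ₛ a) n) ⟨
      xpow (suc k) (u *ₛ a) (suc n)                                ∎

  -- Infinite lower triangular matrices.

  LowerTriangular : Matrix → Set ℓ
  LowerTriangular M = ∀ n k → n < k → M n k ≈ 0#

  shift : Matrix → Matrix
  shift M n k = M (suc n) (suc k)

  -- Matrices unchanged by `shift` are constant along diagonals (Toeplitz).
  ShiftInvariant : Matrix → Set ℓ
  ShiftInvariant M = ∀ n k → shift M n k ≈ M n k

  -- The block-diagonal matrix 1 ⊕ M.
  border : Matrix → Matrix
  border M zero    zero    = 1#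
  border M zero    (suc k) = 0#
  border M (suc n) zero    = 0#
  border M (suc n) (suc k) = M n k

  -- Every T(u | w) is lower triangular, since column k is divisible by x^k; lower
  -- triangularity is inherited by products (from the right factor) and by 1 ⊕ M.
  T-lower : ∀ u w → LowerTriangular (T u w)
  T-lower u w n k n<k = reflexive (xpow-> k _ n n<k)

  ·-lower : ∀ M N → LowerTriangular N → LowerTriangular (M · N)
  ·-lower M N N-lower n k n<k =
    Σ-zero n (λ i i≤n → trans (*-congˡ (N-lower i k (ℕₚ.≤-<-trans i≤n n<k))) (zeroʳ _))

  border-lower : ∀ M → LowerTriangular M → LowerTriangular (border M)
  border-lower M M-lower zero    (suc k) _        = refl
  border-lower M M-lower (suc n) (suc k) 1+n<1+k = M-lower n k (ℕₚ.≤-pred 1+n<1+k)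

  ·-cong : ∀ {M M' N N'} → M ≈ₘ M' → N ≈ₘ N' → (M · N) ≈ₘ (M' · N')
  ·-cong M≈M' N≈N' n k = Σ-cong n (λ i → *-cong (M≈M' n i) (N≈N' i k))

  ·-congˡ : ∀ M {N N'} → N ≈ₘ N' → (M · N) ≈ₘ (M · N')
  ·-congˡ M = ·-cong {M} (λ _ _ → refl)

  ·-congʳ : ∀ {M M'} N → M ≈ₘ M' → (M · N) ≈ₘ (M' · N)
  ·-congʳ N M≈M' = ·-cong {N = N} M≈M' (λ _ _ → refl)

  -- Associativity needs the middle factor lower triangular, because the
  -- defining sum of (M · N) n k is truncated at n.
  ·-assoc : ∀ M N Q → LowerTriangular N → ((M · N) · Q) ≈ₘ (M · (N · Q))
  ·-assoc M N Q N-lower n k = begin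
      Σ≤ n (λ j → Σ≤ n (λ i → M n i * N i j) * Q j k)
        ≈⟨ Σ-cong n (λ j → Σ-*ʳ n (Q j k) (λ i → M n i * N i j)) ⟩
      Σ≤ n (λ j → Σ≤ n (λ i → (M n i * N i j) * Q j k))
        ≈⟨ Σ-swap n n (λ i j → (M n i * N i j) * Q j k) ⟩
      Σ≤ n (λ i → Σ≤ n (λ j → (M n i * N i j) * Q j k))
        ≈⟨ Σ-cong n (λ i → trans (Σ-cong n (λ j → *-assoc _ _ _))
                                 (sym (Σ-*ˡ n (M n i) (λ j → N i j * Q j k)))) ⟩
      Σ≤ n (λ i → M n i * Σ≤ n (λ j → N i j * Q j k))
        ≈⟨ Σ-cong≤ n (λ i i≤n → *-congˡ (sym (Σ-extend i n (λ j → N i j * Q j k) i≤n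
                                         (λ j i<j _ → trans (*-congʳ (N-lower i j i<j)) (zeroˡ _))))) ⟩
      Σ≤ n (λ i → M n i * Σ≤ i (λ j → N i j * Q j k))
        ∎

  I-diagonal : ∀ n → I n n ≈ 1#
  I-diagonal n with n ≟ n
  ... | yes _   = refl
  ... | no  n≢n = ⊥-elim (n≢n ≡.refl)

  I-offDiagonal : ∀ n k → ¬ n ≡.≡ k → I n k ≈ 0#
  I-offDiagonal n k n≢k with n ≟ k
  ... | yes n≡k = ⊥-elim (n≢k n≡k)
  ... | no  _   = refl

  I-shiftInvariant : ShiftInvariant I
  I-shiftInvariant n k with n ≟ k
  ... | yes ≡.refl = I-diagonal (suc n)
  ... | no  n≢k    = I-offDiagonal (suc n) (suc k) (λ 1+n≡1+k → n≢k (ℕₚ.suc-injective 1+n≡1+k))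

  I-symmetric : ∀ n k → I n k ≈ I k n
  I-symmetric n k with n ≟ k
  ... | yes ≡.refl = sym (I-diagonal n)
  ... | no  n≢k    = sym (I-offDiagonal k n (λ k≡n → n≢k (≡.sym k≡n)))

  Σ-I-> : ∀ m k (h : ℕ → Carrier) → m < k → Σ≤ m (λ i → h i * I i k) ≈ 0#
  Σ-I-> m k h m<k = Σ-zero m (λ i i≤m → trans (*-congˡ (I-offDiagonal i k (i≢k i≤m))) (zeroʳ _))
    where
      i≢k : ∀ {i} → i ≤ m → ¬ i ≡.≡ k
      i≢k i≤m = ℕₚ.<⇒≢ (ℕₚ.≤-<-trans i≤m m<k)

  Σ-I-≤ : ∀ m k (h : ℕ → Carrier) → k ≤ m → Σ≤ m (λ i → h i * I i k) ≈ h k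
  Σ-I-≤ zero    .zero h z≤n  = trans (*-congˡ (I-diagonal 0)) (*-identityʳ _)
  Σ-I-≤ (suc m) k     h k≤1+m with ℕₚ.m≤n⇒m<n∨m≡n k≤1+m
  ... | inj₁ k<1+m  = trans (+-cong (Σ-I-≤ m k h (ℕₚ.≤-pred k<1+m))
                                    (trans (*-congˡ (I-offDiagonal (suc m) k (ℕₚ.>⇒≢ k<1+m))) (zeroʳ _)))
                            (+-identityʳ _)
  ... | inj₂ ≡.refl = trans (+-cong (Σ-I-> m (suc m) h ℕₚ.≤-refl)
                                    (trans (*-congˡ (I-diagonal (suc m))) (*-identityʳ _)))
                            (+-identityˡ _)

  -- I is a two-sided identity (on the right only for lower triangular X, because
  -- the product sum is truncated).
  ·-identityʳ : ∀ X → LowerTriangular X → (X · I) ≈ₘ X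
  ·-identityʳ X X-lower n k with k ≤? n
  ... | yes k≤n = Σ-I-≤ n k (X n) k≤n
  ... | no  k≰n = trans (Σ-I-> n k (X n) (ℕₚ.≰⇒> k≰n)) (sym (X-lower n k (ℕₚ.≰⇒> k≰n)))

  ·-identityˡ : ∀ X → (I · X) ≈ₘ X
  ·-identityˡ X n k = trans (Σ-cong n (λ i → trans (*-comm _ _) (*-congˡ (I-symmetric n i))))
                            (Σ-I-≤ n n (λ i → X i k) ℕₚ.≤-refl)

  -- (1 ⊕ M)(1 ⊕ N) = 1 ⊕ MN, read off away from the first row and column.
  border-· : ∀ M N → shift (border M · border N) ≈ₘ (M · N)
  border-· M N n k = trans (Σ-first n (λ i → border M (suc n) i * border N i (suc k)))
                           (trans (+-congʳ (zeroˡ _)) (+-identityˡ _))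

  shift-cong : ∀ {M N} → M ≈ₘ N → shift M ≈ₘ shift N
  shift-cong M≈N n k = M≈N (suc n) (suc k)

  shift-·-border : ∀ M N → shift (M · border N) ≈ₘ (shift M · N)
  shift-·-border M N n k = trans (Σ-first n (λ i → M (suc n) i * border N i (suc k)))
                                 (trans (+-congʳ (zeroʳ _)) (+-identityˡ _))

  ·-border-column₀ : ∀ M N n → (M · border N) n 0 ≈ M n 0
  ·-border-column₀ M N zero    = *-identityʳ _
  ·-border-column₀ M N (suc n) = trans (Σ-first n (λ i → M (suc n) i * border N i 0))
                                       (trans (+-cong (*-identityʳ _) (Σ-zero n (λ i _ → zeroʳ _))) (+-identityʳ _))

  shiftInvariant-unique : ∀ P Q → LowerTriangular P → LowerTriangular Q →
                          ShiftInvariant P → ShiftInvariant Q →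
                          (∀ n → P n 0 ≈ Q n 0) → P ≈ₘ Q
  shiftInvariant-unique P Q P-lower Q-lower P-inv Q-inv column₀ = go
    where
      go : P ≈ₘ Q
      go n       zero    = column₀ n
      go zero    (suc k) = trans (P-lower 0 (suc k) (s≤s z≤n)) (sym (Q-lower 0 (suc k) (s≤s z≤n)))
      go (suc n) (suc k) = trans (P-inv n k) (trans (go n k) (sym (Q-inv n k)))

  -- A lower triangular matrix with nonzero diagonal is left cancellable:
  -- row n of XU = XV determines row n of U from the rows above it.
  ·-cancelˡ : ∀ X U V → (∀ n → X n n ≉ 0#) → (X · U) ≈ₘ (X · V) → U ≈ₘ V
  ·-cancelˡ X U V X-diagonal XU≈XV n = rowsBelow (suc n) n ℕₚ.≤-refl
    where
      row : ∀ n → (∀ i → i < n → ∀ k → U i k ≈ V i k) → ∀ k → U n k ≈ V n k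
      row zero    _       k = *-cancelˡ-nonzero (X-diagonal 0) (XU≈XV 0 k)
      row (suc m) earlier k = *-cancelˡ-nonzero (X-diagonal (suc m))
        (+-cancelˡ _ _ _ (trans (+-congʳ (sym (Σ-cong≤ m (λ i i≤m → *-congˡ (earlier i (s≤s i≤m) k)))))
                                (XU≈XV (suc m) k)))

      rowsBelow : ∀ m i → i < m → ∀ k → U i k ≈ V i k
      rowsBelow (suc m) i i<1+m with ℕₚ.m≤n⇒m<n∨m≡n (ℕₚ.≤-pred i<1+m)
      ... | inj₁ i<m    = rowsBelow m i i<m
      ... | inj₂ ≡.refl = row i (rowsBelow i)

  ·-inverse-comm : ∀ X Y → LowerTriangular X → LowerTriangular Y → (X · Y) ≈ₘ I → (Y · X) ≈ₘ I
  ·-inverse-comm X Y X-lower Y-lower XY≈I = ·-cancelˡ X (Y · X) I X-diagonal X[YX]≈XI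
    where
      XY-diagonal : ∀ n → (X · Y) n n ≈ X n n * Y n n
      XY-diagonal zero    = refl
      XY-diagonal (suc m) =
        trans (+-congʳ (Σ-zero m (λ i i≤m → trans (*-congˡ (Y-lower i (suc m) (s≤s i≤m))) (zeroʳ _))))
              (+-identityˡ _)

      X-diagonal : ∀ n → X n n ≉ 0#
      X-diagonal n Xnn≈0 = 0≉1 (begin
        0#               ≈⟨ zeroˡ _ ⟨
        0# * Y n n       ≈⟨ *-congʳ Xnn≈0 ⟨
        X n n * Y n n    ≈⟨ XY-diagonal n ⟨
        (X · Y) n n      ≈⟨ XY≈I n n ⟩
        I n n            ≈⟨ I-diagonal n ⟩
        1#               ∎)

      X[YX]≈XI : (X · (Y · X)) ≈ₘ (X · I)
      X[YX]≈XI n k = begin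
        (X · (Y · X)) n k  ≈⟨ ·-assoc X Y X Y-lower n k ⟨
        ((X · Y) · X) n k  ≈⟨ ·-congʳ X XY≈I n k ⟩
        (I · X) n k        ≈⟨ ·-identityˡ X n k ⟩
        X n k              ≈⟨ ·-identityʳ X X-lower n k ⟨
        (X · I) n k        ∎

  -- Toeplitz matrices T(u | 1), whose entry in row n and column k ≤ n is u (n - k).

  Toeplitz : Series → Matrix
  Toeplitz u = T u one

  T-cong : ∀ {u u'} w → u ≈ₛ u' → T u w ≈ₘ T u' w
  T-cong w u≈u' n k = xpow-cong k (*ₛ-congʳ (inv (w ^ₛ suc k)) u≈u') n

  -- Column k of T(u | 1) is x^k u, because 1 / 1^{k+1} = 1.
  toeplitz-column : ∀ u k → u *ₛ inv (one ^ₛ suc k) ≈ₛ u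
  toeplitz-column u k m = trans (*ₛ-congˡ u (inv-one-^ₛ (suc k)) m) (*ₛ-one u m)

  toeplitz-entry : ∀ u n k → k ≤ n → Toeplitz u n k ≈ u (n ∸ k)
  toeplitz-entry u n k k≤n = trans (reflexive (xpow-≤ k _ n k≤n)) (toeplitz-column u k (n ∸ k))

  toeplitz-shiftInvariant : ∀ u → ShiftInvariant (Toeplitz u)
  toeplitz-shiftInvariant u n k = trans (reflexive (xpow-suc-suc k _ n))
      (trans (xpow-cong k (toeplitz-column u (suc k)) n) (sym (xpow-cong k (toeplitz-column u k) n)))

  toeplitz-identity : ∀ c → c ≈ₛ one → Toeplitz c ≈ₘ I
  toeplitz-identity c c≈1 n k = trans (xpow-cong k (λ m → trans (toeplitz-column c k m) (c≈1 m)) n) (xpow-one k n)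
    where
      xpow-one : ∀ k n → xpow k one n ≈ I n k
      xpow-one zero    zero    = sym (I-diagonal 0)
      xpow-one zero    (suc n) = sym (I-offDiagonal (suc n) 0 (λ ()))
      xpow-one (suc k) zero    = sym (I-offDiagonal 0 (suc k) (λ ()))
      xpow-one (suc k) (suc n) = trans (reflexive (xpow-suc-suc k one n))
                                       (trans (xpow-one k n) (sym (I-shiftInvariant n k)))

  toeplitz-·-column : ∀ u X n k → (Toeplitz u · X) n k ≈ (u *ₛ (λ i → X i k)) n
  toeplitz-·-column u X n k = trans (Σ-cong≤ n (λ i i≤n → trans (*-congʳ (toeplitz-entry u n i i≤n)) (*-comm _ _)))
                                    (*ₛ-comm (λ i → X i k) u n)

  toeplitz-·-T : ∀ u v w → (Toeplitz u · T v w) ≈ₘ T (u *ₛ v) w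
  toeplitz-·-T u v w n k = begin
      (Toeplitz u · T v w) n k  ≈⟨ toeplitz-·-column u (T v w) n k ⟩
      (u *ₛ xpow k (v *ₛ W)) n  ≈⟨ *ₛ-xpow k u (v *ₛ W) n ⟩
      xpow k (u *ₛ (v *ₛ W)) n  ≈⟨ xpow-cong k (λ m → sym (*ₛ-assoc u v W m)) n ⟩
      T (u *ₛ v) w n k          ∎
    where
      W : Series
      W = inv (w ^ₛ suc k)

  toeplitz-inv-·-T : ∀ f g → f 0 ≉ 0# → (Toeplitz (inv f) · T f g) ≈ₘ T one g
  toeplitz-inv-·-T f g f0≉0 n k = trans (toeplitz-·-T (inv f) f g n k) (T-cong g (inv-*ₛ f f0≉0) n k)

  -- Toeplitz matrices commute with `shift` (the first row of X must vanish off the diagonal).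
  toeplitz-·-shift : ∀ u X → LowerTriangular X → (Toeplitz u · shift X) ≈ₘ shift (Toeplitz u · X)
  toeplitz-·-shift u X X-lower n k = sym (begin
      (Toeplitz u · X) (suc n) (suc k)
        ≈⟨ Σ-first n (λ i → Toeplitz u (suc n) i * X i (suc k)) ⟩
      Toeplitz u (suc n) 0 * X 0 (suc k) + Σ≤ n (λ i → Toeplitz u (suc n) (suc i) * X (suc i) (suc k))
        ≈⟨ +-cong (trans (*-congˡ (X-lower 0 (suc k) (s≤s z≤n))) (zeroʳ _))
                  (Σ-cong n (λ i → *-congʳ (toeplitz-shiftInvariant u n i))) ⟩
      0# + (Toeplitz u · shift X) n k
        ≈⟨ +-identityˡ _ ⟩
      (Toeplitz u · shift X) n k
        ∎)

  -- T(w | 1) T(1 | w) = T(w | w) = 1 ⊕ T(1 | w): column k + 1 of T(w | w) is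
  -- x^{k+1} w / w^{k+2} = x (x^k / w^{k+1}).
  toeplitz-·-T-one : ∀ w → w 0 ≉ 0# → (Toeplitz w · T one w) ≈ₘ border (T one w)
  toeplitz-·-T-one w w0≉0 n k = trans (toeplitz-·-T w one w n k) (T[w|w] n k)
    where
      T[w|w] : T (w *ₛ one) w ≈ₘ border (T one w)
      T[w|w] n zero = trans (reflexive (xpow-zero ((w *ₛ one) *ₛ inv (w *ₛ one)) n))
                            (trans (*ₛ-inv (w *ₛ one) (*-nonzero w0≉0 1≉0) n) (one≈border n))
        where
          one≈border : ∀ n → one n ≈ border (T one w) n 0
          one≈border zero    = refl
          one≈border (suc n) = refl
      T[w|w] n (suc k) = trans (xpow-cong (suc k) column n) (xpow-suc≈border n)
        where
          W : Series
          W = w ^ₛ suc k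

          column : (w *ₛ one) *ₛ inv (w *ₛ W) ≈ₛ one *ₛ inv W
          column m = begin
            ((w *ₛ one) *ₛ inv (w *ₛ W)) m
              ≈⟨ *ₛ-cong (*ₛ-one w) (inv-*ₛ-distrib w W w0≉0 (^ₛ-nonzero w (suc k) w0≉0)) m ⟩
            (w *ₛ (inv w *ₛ inv W)) m          ≈⟨ *ₛ-assoc w (inv w) (inv W) m ⟨
            ((w *ₛ inv w) *ₛ inv W) m          ≈⟨ *ₛ-congʳ (inv W) (*ₛ-inv w w0≉0) m ⟩
            (one *ₛ inv W) m                   ∎

          xpow-suc≈border : ∀ n → xpow (suc k) (one *ₛ inv W) n ≈ border (T one w) n (suc k)
          xpow-suc≈border zero    = reflexive (xpow-suc-zero k (one *ₛ inv W))
          xpow-suc≈border (suc n) = reflexive (xpow-suc-suc k (one *ₛ inv W) n)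

  -- The A-sequence.

  aSequence-matrixForm : ∀ D A → LowerTriangular D → IsASequence D A → shift D ≈ₘ (D · Toeplitz A)
  aSequence-matrixForm D A D-lower isA n k = trans (isA n k) (sym (begin
      (D · Toeplitz A) n k
        ≈⟨ Σ-reindex k n (λ i → D n i * Toeplitz A i k)
             (λ i i<k → trans (*-congˡ (T-lower A one i k i<k)) (zeroʳ _))
             (λ i n<i → trans (*-congʳ (D-lower n i n<i)) (zeroˡ _)) ⟩
      Σ≤ n (λ j → D n (k Nat.+ j) * Toeplitz A (k Nat.+ j) k)
        ≈⟨ Σ-cong n (λ j → trans (*-congˡ (entry j)) (*-comm _ _)) ⟩
      Σ≤ n (λ j → A j * D n (k Nat.+ j))
        ∎))
    where
      entry : ∀ j → Toeplitz A (k Nat.+ j) k ≈ A j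
      entry j = trans (toeplitz-entry A (k Nat.+ j) k (ℕₚ.m≤m+n k j)) (reflexive (≡.cong A (ℕₚ.m+n∸m≡n k j)))

  -- d_{1,1} = a_0 d_{0,0}, so a_0 ≠ 0 as soon as d_{1,1} ≠ 0.
  aSequence-head-nonzero : ∀ D A → IsASequence D A → D 1 1 ≉ 0# → A 0 ≉ 0#
  aSequence-head-nonzero D A isA d₁₁≉0 a₀≈0 = d₁₁≉0 (trans (isA 0 0) (trans (*-congʳ a₀≈0) (zeroˡ _)))

  -- The A-sequence of T(f | g) depends only on g: it is also one of T(1 | g),
  -- since T(1 | g) = T(1/f | 1) T(f | g) and Toeplitz matrices commute with shift.
  aSequence-T-one : ∀ f g A → f 0 ≉ 0# → shift (T f g) ≈ₘ (T f g · Toeplitz A) →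
                    shift (T one g) ≈ₘ (T one g · Toeplitz A)
  aSequence-T-one f g A f0≉0 shiftD≈DÂ n k = begin
      shift E n k              ≈⟨ ·-identityˡ (shift E) n k ⟨
      (I · shift E) n k        ≈⟨ ·-congʳ (shift E) R·F≈I n k ⟨
      ((R · F) · shift E) n k  ≈⟨ ·-assoc R F (shift E) (T-lower f one) n k ⟩
      (R · (F · shift E)) n k  ≈⟨ ·-congˡ R (toeplitz-·-shift f E (T-lower one g)) n k ⟩
      (R · shift (F · E)) n k  ≈⟨ ·-congˡ R (shift-cong F·E≈D) n k ⟩
      (R · shift D) n k        ≈⟨ ·-congˡ R shiftD≈DÂ n k ⟩
      (R · (D · Â)) n k        ≈⟨ ·-assoc R D Â (T-lower f g) n k ⟨
      ((R · D) · Â) n k        ≈⟨ ·-congʳ Â (toeplitz-inv-·-T f g f0≉0) n k ⟩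
      (E · Â) n k              ∎
    where
      D E F R Â : Matrix
      D = T f g
      E = T one g
      F = Toeplitz f
      R = Toeplitz (inv f)
      Â = Toeplitz A

      R·F≈I : (R · F) ≈ₘ I
      R·F≈I n k = trans (toeplitz-inv-·-T f one f0≉0 n k) (toeplitz-identity one (λ _ → refl) n k)

      F·E≈D : (F · E) ≈ₘ D
      F·E≈D n k = trans (toeplitz-·-T f one g n k) (T-cong g (*ₛ-one f) n k)

  -- P = T(1 | g) (1 ⊕ T(1 | A)) is shift-invariant, with first column 1/g, hence
  -- P = T(1/g | 1); and 1 ⊕ T(1 | g) = T(g | 1) T(1 | g), so
  -- 1 ⊕ T(1 | g) T(1 | A) = T(g | 1) P = T(g/g | 1) = I.
  T-one-rightInverse : ∀ g A → g 0 ≉ 0# → A 0 ≉ 0# → shift (T one g) ≈ₘ (T one g · Toeplitz A) →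
                       (T one g · T one A) ≈ₘ I
  T-one-rightInverse g A g0≉0 A0≉0 shiftE≈EÂ n k =
    trans (sym (border-· E L n k)) (trans (bordered (suc n) (suc k)) (I-shiftInvariant n k))
    where
      E L P : Matrix
      E = T one g
      L = T one A
      P = E · border L

      P-shiftInvariant : ShiftInvariant P
      P-shiftInvariant n k = begin
        shift P n k                     ≈⟨ shift-·-border E L n k ⟩
        (shift E · L) n k               ≈⟨ ·-congʳ L shiftE≈EÂ n k ⟩
        ((E · Toeplitz A) · L) n k      ≈⟨ ·-assoc E (Toeplitz A) L (T-lower A one) n k ⟩
        (E · (Toeplitz A · L)) n k      ≈⟨ ·-congˡ E (toeplitz-·-T-one A A0≉0) n k ⟩
        P n k                           ∎

      P-column₀ : ∀ n → P n 0 ≈ Toeplitz (inv g) n 0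
      P-column₀ n = begin
        P n 0                              ≈⟨ ·-border-column₀ E L n ⟩
        E n 0                              ≈⟨ reflexive (xpow-zero (one *ₛ inv (g *ₛ one)) n) ⟩
        (one *ₛ inv (g *ₛ one)) n          ≈⟨ one-*ₛ (inv (g *ₛ one)) n ⟩
        inv (g *ₛ one) n                   ≈⟨ inv-cong (*-nonzero g0≉0 1≉0) (*ₛ-one g) n ⟩
        inv g n                            ≈⟨ toeplitz-entry (inv g) n 0 z≤n ⟨
        Toeplitz (inv g) n 0               ∎

      P≈T[1/g|1] : P ≈ₘ Toeplitz (inv g)
      P≈T[1/g|1] = shiftInvariant-unique P (Toeplitz (inv g))
        (·-lower E (border L) (border-lower L (T-lower one A))) (T-lower (inv g) one)
        P-shiftInvariant (toeplitz-shiftInvariant (inv g)) P-column₀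

      bordered : (border E · border L) ≈ₘ I
      bordered i j = begin
        (border E · border L) i j
          ≈⟨ ·-congʳ (border L) (λ i' j' → sym (toeplitz-·-T-one g g0≉0 i' j')) i j ⟩
        ((Toeplitz g · E) · border L) i j    ≈⟨ ·-assoc (Toeplitz g) E (border L) (T-lower one g) i j ⟩
        (Toeplitz g · P) i j                 ≈⟨ ·-congˡ (Toeplitz g) P≈T[1/g|1] i j ⟩
        (Toeplitz g · Toeplitz (inv g)) i j  ≈⟨ toeplitz-·-T g (inv g) one i j ⟩
        Toeplitz (g *ₛ inv g) i j            ≈⟨ toeplitz-identity (g *ₛ inv g) (*ₛ-inv g g0≉0) i j ⟩
        I i j                                ∎

  -- T(1 | A) is a two-sided inverse of T(1 | g) = T(1/f | 1) T(f | g), so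
  -- M = T(1 | A) T(1/f | 1) is a left inverse of T(f | g), hence also a right inverse.
  riordanInverse : ∀ f g → f 0 ≉ 0# → g 0 ≉ 0# → ∀ A → IsASequence (T f g) A →
                   IsInverseOf (T one A · Toeplitz (inv f)) (T f g)
  riordanInverse f g f0≉0 g0≉0 A isA = D·M≈I , M·D≈I
    where
      D E L R M : Matrix
      D = T f g
      E = T one g
      L = T one A
      R = Toeplitz (inv f)
      M = L · R

      d₁₁≉0 : D 1 1 ≉ 0#
      d₁₁≉0 = *-nonzero f0≉0 (⁻¹-nonzero (^ₛ-nonzero g 2 g0≉0))

      E·L≈I : (E · L) ≈ₘ I
      E·L≈I = T-one-rightInverse g A g0≉0 (aSequence-head-nonzero D A isA d₁₁≉0)
                (aSequence-T-one f g A f0≉0 (aSequence-matrixForm D A (T-lower f g) isA))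

      M·D≈I : (M · D) ≈ₘ I
      M·D≈I n k = begin
        (M · D) n k        ≈⟨ ·-assoc L R D (T-lower (inv f) one) n k ⟩
        (L · (R · D)) n k  ≈⟨ ·-congˡ L (toeplitz-inv-·-T f g f0≉0) n k ⟩
        (L · E) n k        ≈⟨ ·-inverse-comm E L (T-lower one g) (T-lower one A) E·L≈I n k ⟩
        I n k              ∎

      D·M≈I : (D · M) ≈ₘ I
      D·M≈I = ·-inverse-comm M D (·-lower L R (T-lower (inv f) one)) (T-lower f g) M·D≈I

open Riordan

mainTheorem5 : ∀ {c ℓ : Level} (K : Field c ℓ) → CharZero K →
    (f g : Series K) → ConstTermNonzero K f → ConstTermNonzero K g →
    (A : Series K) → IsASequence K (T K f g) A →
    IsInverseOf K (_·_ K (T K (one K) A) (T K (inv K f) (one K))) (T K f g)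
mainTheorem5 K _ f g f0≉0 g0≉0 A isA = RiordanInverse.riordanInverse K f g f0≉0 g0≉0 A isA
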